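{- For all integers $n\ge 4$ and $k$ with $\frac{n}{2}\ge k\ge 2$, there exists a feasible homogeneous irredundant (hence simple) PV graph $\vec G_R$ with $n$ sites and $k$ carriers such that $$\mathcal M(\vec G_R)\ \ge\ n(k-1).$$ This holds even if the agent knows $\vec G_R$, $n$ and $k$ and has unlimited memory.
   Context: A PV system consists of a finite set $S$ of $n$ sites and a set $C$ of $k\le n$ carriers; each carrier $c$ has a unique identifier and a route $\pi(c)=\langle x_0,\dots,x_{p(c)-1}\rangle$ of sites, with period $p(c)$ and $\pi(c)[j]=x_{j\bmod p(c)}$; at each time $t=0,1,\dots$ carrier $c$ moves from $\pi(c)[t]$ to $\pi(c)[t+1]$. The PV graph $\vec G_R$ is the directed edge-labelled multigraph on $S$ with edges $\bigcup_c\{(x_i,x_{i+1},i)\}$ (indices mod $p(c)$). It is homogeneous if all periods are equal. A route is simple if $x_i\ne x_{i+1}$ for all $i$ and $(x_i,x_{i+1})=(x_j,x_{j+1})$ implies $i=j$. A route is irredundant (circular) if it is simple and its directed graph $\{(x_i,x_{i+1})\}$ is either a simple cycle or a virtual cycle, i.e. the closed walk of a simple traversal of a tree (each tree edge traversed once in each direction). The PV graph is irredundant if every route is irredundant. An exploring agent is placed at time $0$ at a starting site $x\in\{\pi(c)[0]:c\in C\}$; at each time $t$, being at site $y$, it either halts or chooses a carrier $c$ with $\pi(c)[t]=y$ and moves with it to $\pi(c)[t+1]$ (one move). $\vec G_R$ is feasible if from every starting site there is a finite sequence of such moves visiting all sites. $\mathcal M(\vec G_R)$ is the minimum, over all agent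 strategies (which may use complete knowledge of $\vec G_R$ and unlimited memory) that from every starting site visit all sites and halt, of the maximum over starting sites of the number of moves made. -}

module Defs where

open import Data.Nat using (ℕ; zero; suc; _≤_; NonZero)
open import Data.Nat.DivMod using (_mod_)
open import Data.Fin using (Fin; toℕ)
open import Data.Product using (Σ; ∃; _×_; _,_; proj₁)
open import Data.Sum using (_⊎_)
open import Relation.Nullary using (¬_)
open import Relation.Binary.PropositionalEquality using (_≡_; _≢_)

-- Routes.  A route of period p is a sequence x : Fin p → Fin n of sites;
-- π[j] = x (j mod p).

module Route {n p : ℕ} .{{_ : NonZero p}} (x : Fin p → Fin n) where

  at : ℕ → Fin n
  at j = x (j mod p)

  nxt : Fin p → Fin n
  nxt i = at (suc (toℕ i))

  Simple : Set
  Simple = (∀ i → x i ≢ nxt i)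
         × (∀ i j → x i ≡ x j → nxt i ≡ nxt j → i ≡ j)

  SimpleCycle : Set
  SimpleCycle = ∀ i j → x i ≡ x j → i ≡ j

  Adj : Fin n → Fin n → Set
  Adj u v = ∃ λ (i : Fin p) → (x i ≡ u × nxt i ≡ v) ⊎ (x i ≡ v × nxt i ≡ u)

  HasCycle : Set
  HasCycle = Σ ℕ λ m → Σ (3 ≤ m) λ m≥3 →
             Σ (Fin m → Fin n) λ f →
               (∀ i j → f i ≡ f j → i ≡ j)
             × (∀ (i : Fin m) → Adj (f i) (f (_mod_ (suc (toℕ i)) m ⦃ nz m≥3 ⦄)))
    where
      nz : ∀ {m} → 3 ≤ m → NonZero m
      nz {suc m} _ = _

  -- virtual cycle: the closed walk is a simple traversal of a tree, i.e.
  -- every traversed edge is also traversed in the opposite direction and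
  -- the underlying undirected graph (connected, since it carries a closed
  -- walk) is acyclic, i.e. a tree.  (Each direction is used exactly once
  -- because the route is simple.)
  VirtualCycle : Set
  VirtualCycle = (∀ i → ∃ λ j → x j ≡ nxt i × nxt j ≡ x i) × ¬ HasCycle

  Irredundant : Set
  Irredundant = Simple × (SimpleCycle ⊎ VirtualCycle)

record PV (n k : ℕ) : Set where
  field
    period    : Fin k → ℕ
    period≢0  : ∀ c → NonZero (period c)
    route     : (c : Fin k) → Fin (period c) → Fin n

  pos : Fin k → ℕ → Fin n
  pos c t = route c (_mod_ t (period c) ⦃ period≢0 c ⦄)

  RouteIrredundant : Fin k → Set
  RouteIrredundant c = Route.Irredundant ⦃ period≢0 c ⦄ (route c)

open PV public

Homogeneous : ∀ {n k} → PV n k → Set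
Homogeneous G = ∀ c d → period G c ≡ period G d

Irredundant : ∀ {n k} → PV n k → Set
Irredundant G = ∀ c → RouteIrredundant G c

IsStart : ∀ {n k} → PV n k → Fin n → Set
IsStart G y = ∃ λ c → pos G c 0 ≡ y

data Walk {n k} (G : PV n k) : ℕ → Fin n → Set where
  halt : ∀ {t y} → Walk G t y
  move : ∀ {t y} (c : Fin k) → pos G c t ≡ y →
         Walk G (suc t) (pos G c (suc t)) → Walk G t y

moves : ∀ {n k} {G : PV n k} {t y} → Walk G t y → ℕ
moves halt = 0
moves (move _ _ w) = suc (moves w)

data Visits {n k} {G : PV n k} : ∀ {t y} → Walk G t y → Fin n → Set where
  here  : ∀ {t y} (w : Walk G t y) → Visits w y
  there : ∀ {t y c e w s} → Visits w s → Visits {t = t} {y = y} (move c e w) s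

Explores : ∀ {n k} {G : PV n k} {t y} → Walk G t y → Set
Explores {n} w = ∀ (s : Fin n) → Visits w s

Feasible : ∀ {n k} → PV n k → Set
Feasible {n} G = ∀ (y : Fin n) → IsStart G y → Σ (Walk G 0 y) Explores

-- a strategy (complete knowledge, unlimited memory, deterministic):
-- for every starting site, an exploring run
Strategy : ∀ {n k} → PV n k → Set
Strategy G = Feasible G

-- 𝓜(G) ≥ N, unfolding 𝓜(G) = min over strategies of max over starting
-- sites of the number of moves
M≥ : ∀ {n k} → PV n k → ℕ → Set
M≥ {n} G N = (σ : Strategy G) →
  ∃ λ (y : Fin n) → Σ (IsStart G y) λ h → N ≤ moves (proj₁ (σ y h))

-- Write n = D + 2 and k = K + 1, so that 1 ≤ K and 2K ≤ D.  The sites are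
-- 0 … p with p = D + 1: the sites 0 … D form a ring ℤ/p and p is an extra
-- site.  Every route has period p and is injective, hence a simple cycle.
-- At time t carrier c has local phase u = (t + c) mod p and stands on the ring
-- site (t + D + e) mod p, where its offset e is 2c, 2c+1 or 2c+2 according as
-- u = 0, 0 < u < D or u = D; the last carrier K keeps the offset 2K and
-- leaves the ring for the extra site exactly at its phase D.
--
-- All offsets are distinct residues below p, so two carriers only meet when
-- carrier c at phase D meets carrier c+1 at phase 0 (lemma `meet`).  Hence an
-- agent riding carrier c at time t has c·D ≤ t (invariant `Reachable`), and
-- reaching the extra site takes (K+1)·D ≥ n·K moves.  Conversely, stepping
-- down this ladder of meetings to carrier 0, riding it once around the ring
-- and then climbing up to carrier K explores everything from every start.
module Submission where

open import Defs
open import Data.Nat using (ℕ; _≤_; _*_; _∸_)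
open import Data.Product using (Σ; _×_)

open import Data.Nat using (zero; suc; _+_; _<_; z≤n; s≤s; z<s; NonZero; >-nonZero⁻¹; _≟_; _≤?_; _%_; _/_)
open import Data.Nat.Properties
open import Data.Nat.DivMod
open import Data.Nat.Divisibility using (_∣_; divides; >⇒∤)
open import Data.Nat.Tactic.RingSolver using (solve-∀)
open import Data.Empty using (⊥-elim)
open import Data.Sum using (_⊎_; inj₁; inj₂)
open import Data.Product using (_,_; proj₁; proj₂)
open import Data.Fin using (Fin; toℕ; fromℕ; fromℕ<)
open import Data.Fin.Properties using (toℕ-injective; toℕ-fromℕ; toℕ-fromℕ<; fromℕ<-toℕ; toℕ<n; toℕ≤pred[n])
open import Relation.Nullary using (Dec; yes; no)
open import Relation.Binary.PropositionalEquality

-- Modular arithmetic on ℕ.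

%-absorbˡ : ∀ m n d .{{_ : NonZero d}} → (m % d + n) % d ≡ (m + n) % d
%-absorbˡ m n d = begin
  (m % d + n) % d          ≡⟨ %-distribˡ-+ (m % d) n d ⟩
  (m % d % d + n % d) % d  ≡⟨ cong (λ x → (x + n % d) % d) (m%n%n≡m%n m d) ⟩
  (m % d + n % d) % d      ≡⟨ %-distribˡ-+ m n d ⟨
  (m + n) % d              ∎
  where open ≡-Reasoning

%-zero-shift : ∀ x y {d} .{{_ : NonZero d}} → x % d ≡ 0 → (x + y) % d ≡ y % d
%-zero-shift x y {d} x≡0 = trans (sym (%-absorbˡ x y d)) (cong (λ r → (r + y) % d) x≡0)

%-stable⇒∣ : ∀ m δ d .{{_ : NonZero d}} → (m + δ) % d ≡ m % d → d ∣ δ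
%-stable⇒∣ m δ d same = divides ((m + δ) / d ∸ m / d) (begin
  δ                                                    ≡⟨ m+n∸m≡n m δ ⟨
  m + δ ∸ m                                            ≡⟨ cong₂ _∸_ (m≡m%n+[m/n]*n (m + δ) d) (m≡m%n+[m/n]*n m d) ⟩
  (m + δ) % d + (m + δ) / d * d ∸ (m % d + m / d * d)  ≡⟨ cong (λ r → r + (m + δ) / d * d ∸ (m % d + m / d * d)) same ⟩
  m % d + (m + δ) / d * d ∸ (m % d + m / d * d)        ≡⟨ [m+n]∸[m+o]≡n∸o (m % d) _ _ ⟩
  (m + δ) / d * d ∸ m / d * d                          ≡⟨ *-distribʳ-∸ d ((m + δ) / d) (m / d) ⟨
  ((m + δ) / d ∸ m / d) * d                            ∎)
  where open ≡-Reasoning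

small-multiple : ∀ {d δ} → d ∣ δ → δ < d → δ ≡ 0
small-multiple {δ = zero}  _   _   = refl
small-multiple {δ = suc _} d∣δ δ<d = ⊥-elim (>⇒∤ δ<d d∣δ)

%-cancel-ordered : ∀ m {a b d} .{{_ : NonZero d}} → a ≤ b → b < d → (m + a) % d ≡ (m + b) % d → a ≡ b
%-cancel-ordered m {a} {b} {d} a≤b b<d same = ≤-antisym a≤b (m∸n≡0⇒m≤n gap≡0)
  where
  shifted : (m + a + (b ∸ a)) % d ≡ (m + a) % d
  shifted = trans (cong (_% d) (trans (+-assoc m a (b ∸ a)) (cong (m +_) (m+[n∸m]≡n a≤b)))) (sym same)
  gap≡0 : b ∸ a ≡ 0
  gap≡0 = small-multiple (%-stable⇒∣ (m + a) (b ∸ a) d shifted) (≤-<-trans (m∸n≤m b a) b<d)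

%-cancelˡ-+ : ∀ m {a b d} .{{_ : NonZero d}} → a < d → b < d → (m + a) % d ≡ (m + b) % d → a ≡ b
%-cancelˡ-+ m {a} {b} a<d b<d same with ≤-total a b
... | inj₁ a≤b = %-cancel-ordered m a≤b b<d same
... | inj₂ b≤a = sym (%-cancel-ordered m b≤a a<d (sym same))

%-cancelʳ-+ : ∀ m {a b d} .{{_ : NonZero d}} → a < d → b < d → (a + m) % d ≡ (b + m) % d → a ≡ b
%-cancelʳ-+ m {a} {b} {d} a<d b<d same =
  %-cancelˡ-+ m a<d b<d (trans (cong (_% d) (+-comm m a)) (trans same (cong (_% d) (+-comm b m))))

≡-mod⇒≤ : ∀ {x y d} .{{_ : NonZero d}} → x % d ≡ y % d → y < x + d → y ≤ x
≡-mod⇒≤ {x} {y} {d} same y<x+d with ≤-total x y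
... | inj₂ y≤x = y≤x
... | inj₁ x≤y = m∸n≡0⇒m≤n (%-cancelˡ-+ x gap<d (>-nonZero⁻¹ d) shifted)
  where
  gap<d : y ∸ x < d
  gap<d = subst (y ∸ x <_) (m+n∸m≡n x d) (∸-monoˡ-< y<x+d x≤y)
  shifted : (x + (y ∸ x)) % d ≡ (x + 0) % d
  shifted = trans (cong (_% d) (m+[n∸m]≡n x≤y)) (trans (sym same) (cong (_% d) (sym (+-identityʳ x))))

-- Riding one carrier in an arbitrary PV graph, and the sites this visits.

module Rides {n k : ℕ} (G : PV n k) where

  ride : (c : Fin k) (d : ℕ) {t : ℕ} → Walk G (d + t) (pos G c (d + t)) → Walk G t (pos G c t)
  ride c zero    w = w
  ride c (suc d) w = ride c d (move c refl w)

  ride-keeps : ∀ c d {t} (w : Walk G (d + t) (pos G c (d + t))) {s} → Visits w s → Visits (ride c d w) s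
  ride-keeps c zero    w v = v
  ride-keeps c (suc d) w v = ride-keeps c d (move c refl w) (there v)

  ride-visits : ∀ c d {t} (w : Walk G (d + t) (pos G c (d + t))) e → e ≤ d →
                Visits (ride c d w) (pos G c (e + t))
  ride-visits c zero    w _ z≤n = here w
  ride-visits c (suc d) w e e≤1+d with m≤n⇒m<n∨m≡n e≤1+d
  ... | inj₁ e<1+d = ride-visits c d (move c refl w) e (≤-pred e<1+d)
  ... | inj₂ refl  = ride-keeps c d (move c refl w) (there (here w))

-- The construction: D + 2 sites and K + 1 carriers, where 1 ≤ K and 2K ≤ D.

module Ladder (D K : ℕ) (1≤K : 1 ≤ K) (2K≤D : 2 * K ≤ D) where

  -- the common period; the ring is 0 … D and p is the extra site
  p : ℕ
  p = suc D

  0<D : 0 < D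
  0<D = ≤-trans (≤-trans (s≤s z≤n) (*-monoʳ-≤ 2 1≤K)) 2K≤D

  D≢0 : D ≢ 0
  D≢0 D≡0 = <⇒≢ 0<D (sym D≡0)

  D%p : D % p ≡ D
  D%p = m<n⇒m%n≡m (n<1+n D)

  data Phase (u : ℕ) : Set where
    top    : u ≡ D → Phase u
    bottom : u ≡ 0 → Phase u
    middle : u ≢ D → u ≢ 0 → Phase u

  phase : (u : ℕ) → Phase u
  phase u with u ≟ D | u ≟ 0
  ... | yes u≡D | _       = top u≡D
  ... | no  _   | yes u≡0 = bottom u≡0
  ... | no  u≢D | no  u≢0 = middle u≢D u≢0

  -- the extra offset of an inner carrier in each regime
  weight : ∀ {u} → Phase u → ℕ
  weight (top _)      = 2
  weight (bottom _)   = 0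
  weight (middle _ _) = 1

  weight≤2 : ∀ {u} (φ : Phase u) → weight φ ≤ 2
  weight≤2 (top _)      = ≤-refl
  weight≤2 (bottom _)   = z≤n
  weight≤2 (middle _ _) = s≤s z≤n

  weight≡2⇒top : ∀ {u} (φ : Phase u) → weight φ ≡ 2 → u ≡ D
  weight≡2⇒top (top u≡D) _ = u≡D

  swap : ∀ {u} → Phase u → ℕ
  swap     (top _)      = 0
  swap     (bottom _)   = D
  swap {u} (middle _ _) = u

  swapAt : ℕ → ℕ
  swapAt u = swap (phase u)

  swapAt-0 : swapAt 0 ≡ D
  swapAt-0 with phase 0
  ... | top 0≡D      = ⊥-elim (D≢0 (sym 0≡D))
  ... | bottom _     = refl
  ... | middle _ 0≢0 = ⊥-elim (0≢0 refl)

  swapAt-D : swapAt D ≡ 0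
  swapAt-D with phase D
  ... | top _        = refl
  ... | bottom D≡0   = ⊥-elim (D≢0 D≡0)
  ... | middle D≢D _ = ⊥-elim (D≢D refl)

  swapAt-middle : ∀ {u} → u ≢ D → u ≢ 0 → swapAt u ≡ u
  swapAt-middle {u} u≢D u≢0 with phase u
  ... | top u≡D      = ⊥-elim (u≢D u≡D)
  ... | bottom u≡0   = ⊥-elim (u≢0 u≡0)
  ... | middle _ _   = refl

  swapAt-involutive : ∀ u → swapAt (swapAt u) ≡ u
  swapAt-involutive u with phase u
  ... | top refl          = swapAt-0
  ... | bottom refl       = swapAt-D
  ... | middle u≢D u≢0    = swapAt-middle u≢D u≢0

  swapAt-injective : ∀ {u u'} → swapAt u ≡ swapAt u' → u ≡ u'
  swapAt-injective {u} {u'} same =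
    trans (sym (swapAt-involutive u)) (trans (cong swapAt same) (swapAt-involutive u'))

  swapAt<p : ∀ {u} → u < p → swapAt u < p
  swapAt<p {u} u<p with phase u
  ... | top _      = z<s
  ... | bottom _   = n<1+n D
  ... | middle _ _ = u<p

  -- In each regime, u + D + weight = swap + weight·p: the offset realises the swap.
  unwind : ∀ {u} (φ : Phase u) → u + D + weight φ ≡ swap φ + weight φ * p
  unwind (top refl)   = double D
    where
    double : ∀ x → x + x + 2 ≡ 0 + 2 * suc x
    double = solve-∀
  unwind (bottom refl) = refl
  unwind {u} (middle _ _) = one-lap u D
    where
    one-lap : ∀ x y → x + y + 1 ≡ x + 1 * suc y
    one-lap = solve-∀

  ringSite : ℕ → ℕ → ℕ
  ringSite t e = (t + D + e) % p

  ringSite<p : ∀ t e → ringSite t e < p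
  ringSite<p t e = m%n<n (t + D + e) p

  ringSite-mod : ∀ t e → ringSite (t % p) e ≡ ringSite t e
  ringSite-mod t e = trans (cong (_% p) (+-assoc (t % p) D e))
                    (trans (%-absorbˡ t (D + e) p) (cong (_% p) (sym (+-assoc t D e))))

  -- Lemmas about `position` case on these two
  -- decisions through helpers that take them as arguments, since a `with`
  -- would also rewrite the hypotheses mentioning `position`.
  place : (c t : ℕ) → Dec (c ≡ K) → ∀ {u} → Phase u → ℕ
  place c t (yes _) (top _) = p
  place c t (yes _) _       = ringSite t (2 * c)
  place c t (no _)  φ       = ringSite t (weight φ + 2 * c)

  position : ℕ → ℕ → ℕ
  position c t = place c t (c ≟ K) (phase ((t + c) % p))

  position-mod : ∀ c t → position c (t % p) ≡ position c t
  position-mod c t = trans (cong (λ u → place c (t % p) (c ≟ K) (phase u)) (%-absorbˡ t c p))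
                           (place-mod (c ≟ K) (phase ((t + c) % p)))
    where
    place-mod : ∀ d {u} (φ : Phase u) → place c (t % p) d φ ≡ place c t d φ
    place-mod (yes _) (top _)      = refl
    place-mod (yes _) (bottom _)   = ringSite-mod t (2 * c)
    place-mod (yes _) (middle _ _) = ringSite-mod t (2 * c)
    place-mod (no _)  φ            = ringSite-mod t (weight φ + 2 * c)

  position-periodic : ∀ c {t t'} → t % p ≡ t' % p → position c t ≡ position c t'
  position-periodic c {t} {t'} same =
    trans (sym (position-mod c t)) (trans (cong (position c) same) (position-mod c t'))

  position≤p : ∀ c t → position c t ≤ p
  position≤p c t = bounded (c ≟ K) (phase ((t + c) % p))
    where
    bounded : ∀ d {u} (φ : Phase u) → place c t d φ ≤ p
    bounded (yes _) (top _)      = ≤-refl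
    bounded (yes _) (bottom _)   = <⇒≤ (ringSite<p t (2 * c))
    bounded (yes _) (middle _ _) = <⇒≤ (ringSite<p t (2 * c))
    bounded (no _)  φ            = <⇒≤ (ringSite<p t (weight φ + 2 * c))

  position-top : ∀ {c t} → c ≢ K → (t + c) % p ≡ D → position c t ≡ ringSite t (2 + 2 * c)
  position-top {c} {t} c≢K u≡D = at (c ≟ K) (phase ((t + c) % p))
    where
    at : ∀ d (φ : Phase ((t + c) % p)) → place c t d φ ≡ ringSite t (2 + 2 * c)
    at (yes c≡K) _           = ⊥-elim (c≢K c≡K)
    at (no _) (top _)        = refl
    at (no _) (bottom u≡0)   = ⊥-elim (D≢0 (trans (sym u≡D) u≡0))
    at (no _) (middle u≢D _) = ⊥-elim (u≢D u≡D)

  position-bottom : ∀ {c t} → (t + c) % p ≡ 0 → position c t ≡ ringSite t (2 * c)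
  position-bottom {c} {t} u≡0 = at (c ≟ K) (phase ((t + c) % p))
    where
    at : ∀ d (φ : Phase ((t + c) % p)) → place c t d φ ≡ ringSite t (2 * c)
    at _       (top u≡D)      = ⊥-elim (D≢0 (trans (sym u≡D) u≡0))
    at _       (middle _ u≢0) = ⊥-elim (u≢0 u≡0)
    at (yes _) (bottom _)     = refl
    at (no _)  (bottom _)     = refl

  position-extra : ∀ {t} → (t + K) % p ≡ D → position K t ≡ p
  position-extra {t} u≡D = at (K ≟ K) (phase ((t + K) % p))
    where
    at : ∀ d (φ : Phase ((t + K) % p)) → place K t d φ ≡ p
    at (no K≢K)  _              = ⊥-elim (K≢K refl)
    at (yes _)   (top _)        = refl
    at (yes _)   (bottom u≡0)   = ⊥-elim (D≢0 (trans (sym u≡D) u≡0))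
    at (yes _)   (middle u≢D _) = ⊥-elim (u≢D u≡D)

  position-last : ∀ {t} → (t + K) % p ≢ D → position K t ≡ ringSite t (2 * K)
  position-last {t} u≢D = at (K ≟ K) (phase ((t + K) % p))
    where
    at : ∀ d (φ : Phase ((t + K) % p)) → place K t d φ ≡ ringSite t (2 * K)
    at (no K≢K) _              = ⊥-elim (K≢K refl)
    at (yes _)  (top u≡D)      = ⊥-elim (u≢D u≡D)
    at (yes _)  (bottom _)     = refl
    at (yes _)  (middle _ _)   = refl

  -- An inner carrier c is at site c + swap(u): its route is a rotated transposition.
  position-inner : ∀ {c t} → c ≢ K → position c t ≡ (c + swapAt ((t + c) % p)) % p
  position-inner {c} {t} c≢K = at (c ≟ K)
    where
    rotate : ∀ x y z w → x + y + (w + 2 * z) ≡ (x + z) + (z + y + w)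
    rotate = solve-∀
    reorder : ∀ u z y w → u + (z + y + w) ≡ z + (u + y + w)
    reorder = solve-∀
    shape : (φ : Phase ((t + c) % p)) → ringSite t (weight φ + 2 * c) ≡ (c + swap φ) % p
    shape φ = begin
      (t + D + (w + 2 * c)) % p        ≡⟨ cong (_% p) (rotate t D c w) ⟩
      ((t + c) + (c + D + w)) % p      ≡⟨ %-absorbˡ (t + c) (c + D + w) p ⟨
      (u + (c + D + w)) % p            ≡⟨ cong (_% p) (reorder u c D w) ⟩
      (c + (u + D + w)) % p            ≡⟨ cong (λ x → (c + x) % p) (unwind φ) ⟩
      (c + (swap φ + w * p)) % p       ≡⟨ cong (_% p) (+-assoc c (swap φ) (w * p)) ⟨
      (c + swap φ + w * p) % p         ≡⟨ [m+kn]%n≡m%n (c + swap φ) w p ⟩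
      (c + swap φ) % p                 ∎
      where
      open ≡-Reasoning
      u = (t + c) % p
      w = weight φ
    at : ∀ d → place c t d (phase ((t + c) % p)) ≡ (c + swapAt ((t + c) % p)) % p
    at (yes c≡K) = ⊥-elim (c≢K c≡K)
    at (no _)    = shape (phase ((t + c) % p))

  -- The largest offset of an inner carrier is still a residue.
  peak≤D : ∀ {c} → c < K → 2 + 2 * c ≤ D
  peak≤D {c} c<K = ≤-trans (≤-reflexive (sym (*-suc 2 c))) (≤-trans (*-monoʳ-≤ 2 c<K) 2K≤D)

  record OnRing (c t : ℕ) : Set where
    field
      offset : ℕ
      site   : position c t ≡ ringSite t offset
      above  : 2 * c ≤ offset
      below  : offset ≤ 2 + 2 * c
      short  : offset < p
      peak   : offset ≡ 2 + 2 * c → (t + c) % p ≡ D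

    off-extra : position c t ≢ p
    off-extra at = <⇒≢ (subst (_< p) (sym site) (ringSite<p t offset)) at

  data Location (c t : ℕ) : Set where
    atExtra : c ≡ K → (t + c) % p ≡ D → position c t ≡ p → Location c t
    onRing  : OnRing c t → Location c t

  locate : ∀ {c} t → c ≤ K → Location c t
  locate {c} t c≤K = classify (c ≟ K) (phase ((t + c) % p)) refl
    where
    last-on-ring : c ≡ K → position c t ≡ ringSite t (2 * c) → OnRing c t
    last-on-ring c≡K at = record
      { offset = 2 * c ; site = at ; above = ≤-refl ; below = m≤n+m (2 * c) 2
      ; short = s≤s (subst (λ x → 2 * x ≤ D) (sym c≡K) 2K≤D)
      ; peak = λ e → ⊥-elim (<⇒≢ (m<n+m (2 * c) {2} z<s) e) }
    inner-on-ring : c ≢ K → (φ : Phase ((t + c) % p)) →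
                    position c t ≡ ringSite t (weight φ + 2 * c) → OnRing c t
    inner-on-ring c≢K φ at = record
      { offset = weight φ + 2 * c ; site = at ; above = m≤n+m (2 * c) (weight φ)
      ; below = +-monoˡ-≤ (2 * c) (weight≤2 φ)
      ; short = s≤s (≤-trans (+-monoˡ-≤ (2 * c) (weight≤2 φ)) (peak≤D (≤∧≢⇒< c≤K c≢K)))
      ; peak = λ e → weight≡2⇒top φ (+-cancelʳ-≡ (2 * c) (weight φ) 2 e) }
    classify : ∀ d (φ : Phase ((t + c) % p)) → position c t ≡ place c t d φ → Location c t
    classify (yes c≡K) (top u≡D)    at = atExtra c≡K u≡D at
    classify (yes c≡K) (bottom _)   at = onRing (last-on-ring c≡K at)
    classify (yes c≡K) (middle _ _) at = onRing (last-on-ring c≡K at)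
    classify (no c≢K)  φ            at = onRing (inner-on-ring c≢K φ at)

  meet : ∀ {c c'} t → c ≤ K → c' ≤ K → position c' t ≡ position c t →
         c' ≤ c ⊎ (c' ≡ suc c × (t + c) % p ≡ D)
  meet {c} {c'} t c≤K c'≤K same with locate t c≤K | locate t c'≤K
  ... | atExtra c≡K _ _ | atExtra c'≡K _ _ = inj₁ (≤-reflexive (trans c'≡K (sym c≡K)))
  ... | atExtra _ _ at  | onRing R'        = ⊥-elim (OnRing.off-extra R' (trans same at))
  ... | onRing R        | atExtra _ _ at   = ⊥-elim (OnRing.off-extra R (trans (sym same) at))
  ... | onRing R        | onRing R'        with c' ≤? c
  ...   | yes c'≤c = inj₁ c'≤c
  ...   | no  c'≰c = inj₂ (≤-antisym c'≤1+c c<c' , OnRing.peak R e≡top)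
    where
    open OnRing
    e≡e : offset R' ≡ offset R
    e≡e = %-cancelˡ-+ (t + D) (short R') (short R) (trans (sym (site R')) (trans same (site R)))
    c<c' : suc c ≤ c'
    c<c' = ≰⇒> c'≰c
    e≡top : offset R ≡ 2 + 2 * c
    e≡top = ≤-antisym (below R) (begin
      2 + 2 * c  ≡⟨ *-suc 2 c ⟨
      2 * suc c  ≤⟨ *-monoʳ-≤ 2 c<c' ⟩
      2 * c'     ≤⟨ above R' ⟩
      offset R'  ≡⟨ e≡e ⟩
      offset R   ∎)
      where open ≤-Reasoning
    c'≤1+c : c' ≤ suc c
    c'≤1+c = *-cancelˡ-≤ 2 (begin
      2 * c'     ≤⟨ above R' ⟩
      offset R'  ≡⟨ e≡e ⟩
      offset R   ≤⟨ below R ⟩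
      2 + 2 * c  ≡⟨ *-suc 2 c ⟨
      2 * suc c  ∎)
      where open ≤-Reasoning

  handover : ∀ {c t} → c < K → (t + c) % p ≡ D → position c t ≡ position (suc c) t
  handover {c} {t} c<K u≡D = begin
    position c t               ≡⟨ position-top (<⇒≢ c<K) u≡D ⟩
    ringSite t (2 + 2 * c)     ≡⟨ cong (ringSite t) (*-suc 2 c) ⟨
    ringSite t (2 * suc c)     ≡⟨ position-bottom {suc c} next-phase ⟨
    position (suc c) t         ∎
    where
    open ≡-Reasoning
    next-phase : (t + suc c) % p ≡ 0
    next-phase = begin
      (t + suc c) % p        ≡⟨ cong (_% p) (trans (+-suc t c) (+-comm 1 (t + c))) ⟩
      (t + c + 1) % p        ≡⟨ %-absorbˡ (t + c) 1 p ⟨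
      ((t + c) % p + 1) % p  ≡⟨ cong (λ x → (x + 1) % p) u≡D ⟩
      (D + 1) % p            ≡⟨ cong (_% p) (+-comm D 1) ⟩
      p % p                  ≡⟨ n%n≡0 p ⟩
      0                      ∎

  inner-injective : ∀ {c t t'} → c ≢ K → t < p → t' < p → position c t ≡ position c t' → t ≡ t'
  inner-injective {c} {t} {t'} c≢K t<p t'<p same = %-cancelʳ-+ c t<p t'<p (swapAt-injective (%-cancelˡ-+ c
    (swapAt<p (m%n<n (t + c) p)) (swapAt<p (m%n<n (t' + c) p))
    (trans (sym (position-inner c≢K)) (trans same (position-inner c≢K)))))

  last-injective : ∀ {t t'} → t < p → t' < p → position K t ≡ position K t' → t ≡ t'
  last-injective {t} {t'} t<p t'<p same = by-phase ((t + K) % p ≟ D) ((t' + K) % p ≟ D)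
    where
    open ≡-Reasoning
    by-phase : Dec ((t + K) % p ≡ D) → Dec ((t' + K) % p ≡ D) → t ≡ t'
    by-phase (yes u≡D) (yes u'≡D) = %-cancelʳ-+ K t<p t'<p (trans u≡D (sym u'≡D))
    by-phase (yes u≡D) (no u'≢D)  = ⊥-elim (<⇒≢ (ringSite<p t' (2 * K))
      (trans (sym (position-last u'≢D)) (trans (sym same) (position-extra u≡D))))
    by-phase (no u≢D)  (yes u'≡D) = ⊥-elim (<⇒≢ (ringSite<p t (2 * K))
      (trans (sym (position-last u≢D)) (trans same (position-extra u'≡D))))
    by-phase (no u≢D)  (no u'≢D)  = %-cancelʳ-+ (D + 2 * K) t<p t'<p (begin
      (t + (D + 2 * K)) % p    ≡⟨ cong (_% p) (+-assoc t D (2 * K)) ⟨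
      ringSite t (2 * K)       ≡⟨ trans (sym (position-last u≢D)) (trans same (position-last u'≢D)) ⟩
      ringSite t' (2 * K)      ≡⟨ cong (_% p) (+-assoc t' D (2 * K)) ⟩
      (t' + (D + 2 * K)) % p   ∎)

  position-injective : ∀ {c t t'} → t < p → t' < p → position c t ≡ position c t' → t ≡ t'
  position-injective {c} {t} {t'} t<p t'<p same = by-rank (c ≟ K)
    where
    by-rank : Dec (c ≡ K) → t ≡ t'
    by-rank (yes c≡K) = last-injective t<p t'<p (subst (λ x → position x t ≡ position x t') c≡K same)
    by-rank (no c≢K)  = inner-injective c≢K t<p t'<p same

  carrier0-covers : ∀ {v} → v < p → Σ ℕ λ t → t < p × position 0 t ≡ v
  carrier0-covers {v} v<p = swapAt v , t<p , (begin
    position 0 t                    ≡⟨ position-inner 0≢K ⟩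
    swapAt ((t + 0) % p) % p        ≡⟨ cong (λ x → swapAt x % p) t%p ⟩
    swapAt (swapAt v) % p           ≡⟨ cong (_% p) (swapAt-involutive v) ⟩
    v % p                           ≡⟨ m<n⇒m%n≡m v<p ⟩
    v                               ∎)
    where
    open ≡-Reasoning
    t = swapAt v
    t<p = swapAt<p v<p
    t%p : (t + 0) % p ≡ t
    t%p = trans (cong (_% p) (+-identityʳ t)) (m<n⇒m%n≡m t<p)
    0≢K : 0 ≢ K
    0≢K 0≡K = <⇒≢ 1≤K 0≡K

  ladder : PV (suc p) (suc K)
  ladder = record
    { period   = λ _ → p
    ; period≢0 = λ _ → _
    ; route    = λ c r → fromℕ< (s≤s (position≤p (toℕ c) (toℕ r)))
    }

  extra : Fin (suc p)
  extra = fromℕ p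

  pos-toℕ : ∀ c t → toℕ (pos ladder c t) ≡ position (toℕ c) t
  pos-toℕ c t = begin
    toℕ (pos ladder c t)              ≡⟨ toℕ-fromℕ< _ ⟩
    position (toℕ c) (toℕ (t mod p))  ≡⟨ cong (position (toℕ c)) (toℕ-fromℕ< _) ⟩
    position (toℕ c) (t % p)          ≡⟨ position-mod (toℕ c) t ⟩
    position (toℕ c) t                ∎
    where open ≡-Reasoning

  toℕ≤K : (c : Fin (suc K)) → toℕ c ≤ K
  toℕ≤K = toℕ≤pred[n]

  -- Lower bound: every run from carrier 0 needs (K + 1)·D moves to reach the extra site.

  climb : ∀ {c t} → c * D ≤ t → (t + c) % p ≡ D → suc c * D ≤ t
  climb {c} {t} cD≤t u≡D = +-cancelʳ-≤ c (suc c * D) t (≡-mod⇒≤ same-phase early)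
    where
    laps : ∀ c D → suc c * D + c ≡ D + c * suc D
    laps = solve-∀
    regroup : ∀ t c D → D + t + c ≡ t + c + D
    regroup = solve-∀
    same-phase : (t + c) % p ≡ (suc c * D + c) % p
    same-phase = begin
      (t + c) % p            ≡⟨ u≡D ⟩
      D                      ≡⟨ D%p ⟨
      D % p                  ≡⟨ [m+kn]%n≡m%n D c p ⟨
      (D + c * p) % p        ≡⟨ cong (_% p) (laps c D) ⟨
      (suc c * D + c) % p    ∎
      where open ≡-Reasoning
    early : suc c * D + c < t + c + p
    early = begin-strict
      D + c * D + c  ≤⟨ +-monoˡ-≤ c (+-monoʳ-≤ D cD≤t) ⟩
      D + t + c      ≡⟨ regroup t c D ⟩
      t + c + D      <⟨ +-monoʳ-< (t + c) (n<1+n D) ⟩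
      t + c + p      ∎
      where open ≤-Reasoning

  -- Invariant of every run from carrier 0 at time 0: the agent at y at time t
  -- rides a carrier c with c·D ≤ t.
  Reachable : ℕ → Fin (suc p) → Set
  Reachable t y = Σ (Fin (suc K)) λ c → toℕ c * D ≤ t × pos ladder c t ≡ y

  step : ∀ {t y} → Reachable t y → ∀ c' → pos ladder c' t ≡ y → Reachable (suc t) (pos ladder c' (suc t))
  step {t} (c , cD≤t , c-at) c' c'-at = c' , ≤-trans boarded (n≤1+n t) , refl
    where
    same : position (toℕ c') t ≡ position (toℕ c) t
    same = trans (sym (pos-toℕ c' t)) (trans (cong toℕ (trans c'-at (sym c-at))) (pos-toℕ c t))
    boarded : toℕ c' * D ≤ t
    boarded with meet t (toℕ≤K c) (toℕ≤K c') same
    ... | inj₁ c'≤c          = ≤-trans (*-monoˡ-≤ D c'≤c) cD≤t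
    ... | inj₂ (c'≡1+c , u≡D) = subst (λ x → x * D ≤ t) (sym c'≡1+c) (climb cD≤t u≡D)

  extra-late : ∀ {t} → Reachable t extra → suc K * D ≤ t
  extra-late {t} (c , cD≤t , c-at) with locate t (toℕ≤K c)
  ... | atExtra c≡K u≡D _ = subst (λ x → suc x * D ≤ t) c≡K (climb cD≤t u≡D)
  ... | onRing R = ⊥-elim (OnRing.off-extra R
          (trans (sym (pos-toℕ c t)) (trans (cong toℕ c-at) (toℕ-fromℕ p))))

  walk-late : ∀ {t y} (w : Walk ladder t y) → Reachable t y → Visits w extra → suc K * D ≤ t + moves w
  walk-late {t} w            r (here _)  = ≤-trans (extra-late r) (m≤m+n t (moves w))
  walk-late {t} (move c e w) r (there v) =
    ≤-trans (walk-late w (step r c e) v) (≤-reflexive (sym (+-suc t (moves w))))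

  size : suc p * K ≤ suc K * D
  size = begin
    suc p * K      ≡⟨ expand K D ⟩
    2 * K + K * D  ≤⟨ +-monoˡ-≤ (K * D) 2K≤D ⟩
    D + K * D      ∎
    where
    open ≤-Reasoning
    expand : ∀ K D → suc (suc D) * K ≡ 2 * K + K * D
    expand = solve-∀

  lower-bound : M≥ ladder (suc p * K)
  lower-bound σ = start , (Fin.zero , refl) ,
    ≤-trans size (walk-late (proj₁ run) (Fin.zero , z≤n , refl) (proj₂ run extra))
    where
    start = pos ladder Fin.zero 0
    run = σ start (Fin.zero , refl)

  -- Feasibility: from every start, descend to carrier 0, tour the ring, climb to the extra site.

  open Rides ladder

  carrier : (j : ℕ) → j ≤ K → Fin (suc K)
  carrier j j≤K = fromℕ< (s≤s j≤K)

  From : Fin (suc K) → ℕ → Set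
  From c t = Walk ladder t (pos ladder c t)

  pos-carrier : ∀ {j} (h : j ≤ K) t → toℕ (pos ladder (carrier j h) t) ≡ position j t
  pos-carrier h t = trans (pos-toℕ (carrier _ h) t) (cong (λ c → position c t) (toℕ-fromℕ< (s≤s h)))

  together : ∀ {j j'} (h : j ≤ K) (h' : j' ≤ K) t → position j t ≡ position j' t →
             pos ladder (carrier j h) t ≡ pos ladder (carrier j' h') t
  together h h' t same = toℕ-injective (trans (pos-carrier h t) (trans same (sym (pos-carrier h' t))))

  top-after : ∀ {T j} → (T + j) % p ≡ 0 → (D + T + j) % p ≡ D
  top-after {T} {j} u≡0 = trans (cong (_% p) (regroup D T j)) (trans (%-zero-shift (T + j) D u≡0) D%p)
    where
    regroup : ∀ D T j → D + T + j ≡ T + j + D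
    regroup = solve-∀

  bottom-after : ∀ {T j} → (T + j) % p ≡ 0 → (D + T + suc j) % p ≡ 0
  bottom-after {T} {j} u≡0 = trans (cong (_% p) (regroup D T j)) (trans ([m+n]%n≡m%n (T + j) p) u≡0)
    where
    regroup : ∀ D T j → D + T + suc j ≡ T + j + suc D
    regroup = solve-∀

  -- Climbing the ladder: from carrier j at its phase 0, ride D steps and hand
  -- over to carrier j + 1, until carrier K brings the agent to the extra site.
  ascend : ∀ d j (h : j ≤ K) → d + j ≡ K → ∀ T → (T + j) % p ≡ 0 →
           Σ (From (carrier j h) T) λ w → Visits w extra
  ascend zero .K h refl T u≡0 = ride c D halt , subst (Visits _) arrive (ride-visits c D halt D ≤-refl)
    where
    c = carrier K h
    arrive : pos ladder c (D + T) ≡ extra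
    arrive = toℕ-injective (trans (pos-carrier h (D + T))
               (trans (position-extra (top-after u≡0)) (sym (toℕ-fromℕ p))))
  ascend (suc d) j h 1+d+j≡K T u≡0 = ride c D (proj₁ rest) , ride-keeps c D (proj₁ rest) (proj₂ rest)
    where
    c = carrier j h
    j<K : j < K
    j<K = subst (j <_) 1+d+j≡K (s≤s (m≤n+m j d))
    switch : pos ladder (carrier (suc j) j<K) (D + T) ≡ pos ladder c (D + T)
    switch = together j<K h (D + T) (sym (handover j<K (top-after u≡0)))
    rest : Σ (Walk ladder (D + T) (pos ladder c (D + T))) λ w → Visits w extra
    rest = subst (λ y → Σ (Walk ladder (D + T) y) λ w → Visits w extra) switch
             (ascend d (suc j) j<K (trans (+-suc d j) 1+d+j≡K) (D + T) (bottom-after u≡0))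

  tour : ∀ T → (T + 0) % p ≡ 0 → Σ (From Fin.zero T) Explores
  tour T u≡0 = w , covers
    where
    later : (p + T + 0) % p ≡ 0
    later = trans (cong (_% p) (+-assoc p T 0)) (trans (%-zero-shift p (T + 0) (n%n≡0 p)) u≡0)
    up = ascend K 0 z≤n (+-identityʳ K) (p + T) later
    w = ride Fin.zero p (proj₁ up)
    covers : Explores w
    covers s with m≤n⇒m<n∨m≡n (toℕ≤pred[n] s)
    ... | inj₂ s≡p = subst (Visits w) (toℕ-injective (trans (toℕ-fromℕ p) (sym s≡p)))
                       (ride-keeps Fin.zero p (proj₁ up) (proj₂ up))
    ... | inj₁ s<p with carrier0-covers s<p
    ...   | r , r<p , r-at = subst (Visits w) here≡s (ride-visits Fin.zero p (proj₁ up) r (<⇒≤ r<p))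
      where
      shift : (r + T) % p ≡ r % p
      shift = trans (cong (_% p) (+-comm r T)) (%-zero-shift T r (trans (cong (_% p) (sym (+-identityʳ T))) u≡0))
      here≡s : pos ladder Fin.zero (r + T) ≡ s
      here≡s = toℕ-injective (trans (pos-toℕ Fin.zero (r + T)) (trans (position-periodic 0 shift) r-at))

  -- Descending the ladder: carrier i + 1 at its phase 0 meets carrier i at its
  -- phase D; one step later carrier i is at its phase 0, and the descent goes on.
  descend : ∀ j (h : j ≤ K) T → (T + j) % p ≡ 0 → Σ (From (carrier j h) T) Explores
  descend zero    _ T u≡0 = tour T u≡0
  descend (suc i) h T u≡0 = move (carrier i i≤K) switch (proj₁ rest) , λ s → there (proj₂ rest s)
    where
    i≤K = ≤-trans (n≤1+n i) h
    top-of-i : (T + i) % p ≡ D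
    top-of-i = %-pred-≡0 (trans (cong (_% p) (sym (+-suc T i))) u≡0)
    switch : pos ladder (carrier i i≤K) T ≡ pos ladder (carrier (suc i) h) T
    switch = together i≤K h T (handover h top-of-i)
    rest = descend i i≤K (suc T) (trans (cong (_% p) (sym (+-suc T i))) u≡0)

  explore-from : (c : Fin (suc K)) → Σ (From c 0) Explores
  explore-from c = ride c wait (proj₁ rest) , λ s → ride-keeps c wait (proj₁ rest) (proj₂ rest s)
    where
    j = toℕ c
    wait = p ∸ j
    j≤p : j ≤ p
    j≤p = ≤-trans (toℕ≤K c) (≤-trans (m≤m+n K (K + 0)) (≤-trans 2K≤D (n≤1+n D)))
    phase0 : (wait + 0 + j) % p ≡ 0
    phase0 = trans (cong (λ x → (x + j) % p) (+-identityʳ wait))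
               (trans (cong (_% p) (m∸n+n≡m j≤p)) (n%n≡0 p))
    rest : Σ (From c (wait + 0)) Explores
    rest = subst (λ c' → Σ (From c' (wait + 0)) Explores) (fromℕ<-toℕ c (s≤s (toℕ≤K c)))
             (descend j (toℕ≤K c) (wait + 0) phase0)

  feasible : Feasible ladder
  feasible y (c , c-at) = subst (λ y → Σ (Walk ladder 0 y) Explores) c-at (explore-from c)

  -- Irredundancy: every route is injective, hence a simple cycle.

  route-injective : ∀ c (i j : Fin p) → route ladder c i ≡ route ladder c j → i ≡ j
  route-injective c i j same = toℕ-injective (position-injective {toℕ c} (toℕ<n i) (toℕ<n j)
    (trans (sym (toℕ-fromℕ< (s≤s (position≤p (toℕ c) (toℕ i)))))
      (trans (cong toℕ same) (toℕ-fromℕ< (s≤s (position≤p (toℕ c) (toℕ j)))))))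

  -- A position and its successor differ, as p ≥ 2.
  ≢-suc-mod : ∀ {i} → i < p → i ≢ suc i % p
  ≢-suc-mod {i} i<p i≡ = 0≢1 (%-cancelˡ-+ i z<s (s≤s 0<D) (begin
    (i + 0) % p  ≡⟨ cong (_% p) (+-identityʳ i) ⟩
    i % p        ≡⟨ m<n⇒m%n≡m i<p ⟩
    i            ≡⟨ i≡ ⟩
    suc i % p    ≡⟨ cong (_% p) (+-comm 1 i) ⟩
    (i + 1) % p  ∎))
    where
    open ≡-Reasoning
    0≢1 : 0 ≢ 1
    0≢1 ()

  irredundant : Irredundant ladder
  irredundant c = (no-stay , λ i j same _ → route-injective c i j same) , inj₁ (route-injective c)
    where
    no-stay : ∀ i → route ladder c i ≢ route ladder c (suc (toℕ i) mod p)
    no-stay i same = ≢-suc-mod (toℕ<n i) (trans (cong toℕ (route-injective c _ _ same)) (toℕ-fromℕ< _))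

  ladder-graph : Σ (PV (suc p) (suc K)) λ G →
    Homogeneous G × Irredundant G × Feasible G × M≥ G (suc p * (suc K ∸ 1))
  ladder-graph = ladder , (λ _ _ → refl) , irredundant , feasible , lower-bound

theorem7 : (n k : ℕ) → 4 ≤ n → 2 ≤ k → 2 * k ≤ n →
    Σ (PV n k) λ G → Homogeneous G × Irredundant G × Feasible G × M≥ G (n * (k ∸ 1))
theorem7 (suc (suc D)) (suc K) _ (s≤s 1≤K) 2k≤n =
  Ladder.ladder-graph D K 1≤K (≤-pred (≤-pred (subst (_≤ suc (suc D)) (*-suc 2 K) 2k≤n)))
theorem7 0             _       ()          _  _
theorem7 1             _       (s≤s ())    _  _
theorem7 (suc (suc _)) 0       _           () _
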